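{- Let $m$ be a positive integer and let $\delta$ be a positive divisor of $\lambda(m)$. Then: (1) if $\delta=1$, $\displaystyle\sum_{\substack{a\in U_m\\ \mathrm{ind}_m(a)=1}} a\equiv 1\pmod m$; (2) if $\delta=2$, $\displaystyle\sum_{\substack{a\in U_m\\ \mathrm{ind}_m(a)=2}} a\equiv -1\pmod m$; (3) if $4\mid\delta$, $\displaystyle\sum_{\substack{a\in U_m\\ \mathrm{ind}_m(a)=\delta}} a\equiv 0\pmod m$.
   Context: $U_m$ denotes the set of invertible elements of $\mathbb{Z}/m\mathbb{Z}$ (sums are taken of residues, or equivalently of representatives in $\{1,\dots,m\}$). For $a\in U_m$, $\mathrm{ind}_m(a)$ is the smallest positive integer $k$ with $a^k\equiv 1\pmod m$ (the multiplicative order of $a$). $\lambda(m)$ is the Carmichael function: the least $k>0$ such that $a^k\equiv1\pmod m$ for all $a\in U_m$. -}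

module Defs where

open import Data.Nat using (ℕ; zero; suc; _+_; _*_; _^_; _<_; _≡ᵇ_; NonZero)
open import Data.Nat.DivMod using (_%_)
open import Data.Nat.GCD using (gcd)
open import Data.Nat.Coprimality using (Coprime)
open import Data.Bool using (Bool; _∧_; not)
open import Data.List using (List; map; upTo; filterᵇ; all)
open import Data.Nat.ListAction using (sum)
open import Relation.Binary.PropositionalEquality using (_≡_; _≢_)

units : ℕ → List ℕ
units m = filterᵇ (λ a → gcd a m ≡ᵇ 1) (map suc (upTo m))

powOneᵇ : (m : ℕ) → .{{NonZero m}} → ℕ → ℕ → Bool
powOneᵇ m a k = ((a ^ k) % m) ≡ᵇ (1 % m)

-- hasIndᵇ m a δ = true  iff  ind_m(a) = δ, i.e. δ is the smallest
-- positive integer with a^δ ≡ 1 (mod m).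
hasIndᵇ : (m : ℕ) → .{{NonZero m}} → ℕ → ℕ → Bool
hasIndᵇ m a zero = Data.Bool.false
hasIndᵇ m a (suc d) =
  powOneᵇ m a (suc d) ∧ all (λ j → not (powOneᵇ m a (suc j))) (upTo d)

sumInd : (m : ℕ) → .{{NonZero m}} → ℕ → ℕ
sumInd m δ = sum (filterᵇ (λ a → hasIndᵇ m a δ) (units m))

IsCarmichael : (m : ℕ) → .{{NonZero m}} → ℕ → Set
IsCarmichael m L =
  (0 < L)
  × ((a : ℕ) → Coprime a m → (a ^ L) % m ≡ 1 % m)
  × ((k : ℕ) → 0 < k → k < L →
       ¬ ((a : ℕ) → Coprime a m → (a ^ k) % m ≡ 1 % m))
  where
    open import Data.Product using (_×_)
    open import Relation.Nullary using (¬_)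

-- The map a ↦ m − a permutes U_m and, for m > 2, has no fixed point, so every subset of U_m
-- closed under it has sum ≡ 0 (mod m): its elements pair off into sums equal to m.  Since
-- (m − a)² ≡ a², two such subsets are the square roots of 1 and, when 4 ∣ δ, the elements of
-- order δ: if y² ≡ x² and x has order δ with 4 ∣ δ, then yᵏ ≡ 1 gives x²ᵏ ≡ 1, hence δ ∣ 2k,
-- so k is even and xᵏ ≡ yᵏ.  The square roots of 1 are 1 and the elements of order 2, which
-- gives (2), and (1) holds because 1 is the only element of order 1.  The hypothesis δ ∣ λ(m)
-- only serves to exclude m ≤ 2 when δ ≥ 2, since λ(1) = λ(2) = 1.
module Submission where

open import Defs

open import Data.Bool using (Bool; true; false; T; not; _∧_; if_then_else_)
open import Data.Bool.Properties using (T?; T-∧; T-≡; ⇔→≡; ∧-identityʳ)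
open import Data.List using (List; []; _∷_; _∷ʳ_; map; filterᵇ; applyUpTo; upTo)
open import Data.List.Properties
  using (applyUpTo-∷ʳ; map-upTo; filter-accept; filter-reject; filter-none)
open import Data.List.Relation.Unary.All as All using (All; []; _∷_)
open import Data.List.Relation.Unary.All.Properties using (all⁺; all⁻; applyUpTo⁺₁; applyUpTo⁻; map⁺)
open import Data.Nat
  using (ℕ; zero; suc; _+_; _*_; _^_; _<_; _≤_; _≡ᵇ_; z≤n; s≤s; z<s; s<s; NonZero; >-nonZero)
open import Data.Nat.Coprimality using (Coprime)
open import Data.Nat.DivMod
  using (_%_; _/_; %-distribˡ-*; m≡m%n+[m/n]*n; m%n<n; [m+kn]%n≡m%n; m<n⇒m%n≡m; n%n≡0; n%1≡0)
open import Data.Nat.Divisibility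
  using (_∣_; divides; divides-refl; _∣0; ∣-refl; ∣-trans; ∣m∣n⇒∣m+n; n∣m*n; *-cancelʳ-∣; ∣1⇒≡1; ∣⇒≤;
         m%n≡0⇒n∣m; n∣m⇒m%n≡0)
open import Data.Nat.GCD using (gcd; gcd-GCD; gcd-comm; gcd-identityˡ; gcd-zeroˡ; module GCD)
open import Data.Nat.ListAction using (sum)
open import Data.Nat.ListAction.Properties using (sum-++)
open import Data.Nat.Properties
  using (≡ᵇ⇒≡; ≡⇒≡ᵇ; +-identityʳ; +-suc; +-comm; *-comm; *-identityʳ; ^-*-assoc; ^-zeroˡ; ^-identityʳ;
         ^-distribˡ-+-*; 0≢1+n; <-trans; <⇒≢; ≤-antisym; ≤-trans; ≤-reflexive; ≮⇒≥; ≰⇒>; m≤n⇒m<n∨m≡n)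
open import Data.Nat.Tactic.RingSolver using (solve-∀)
open import Data.Product using (_×_; _,_; proj₁; proj₂)
open import Data.Sum using (inj₁; inj₂)
open import Function using (_∘_; _⇔_; mk⇔; Equivalence)
import Function.Properties.Equivalence as ⇔
open import Relation.Binary.PropositionalEquality
open import Relation.Nullary using (¬_; contradiction)

T-not : ∀ {b} → T (not b) ⇔ (¬ T b)
T-not {false} = mk⇔ (λ _ ()) (λ _ → _)
T-not {true}  = mk⇔ (λ ()) (λ ¬t → ¬t _)

T-⇔⇒≡ : ∀ {a b} → T a ⇔ T b → a ≡ b
T-⇔⇒≡ Ta⇔Tb = ⇔→≡ (⇔.trans (⇔.sym T-≡) (⇔.trans Ta⇔Tb T-≡))

filterᵇ-filterᵇ : ∀ {A : Set} (p q : A → Bool) xs →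
                  filterᵇ q (filterᵇ p xs) ≡ filterᵇ (λ x → p x ∧ q x) xs
filterᵇ-filterᵇ p q [] = refl
filterᵇ-filterᵇ p q (x ∷ xs) with p x
... | false = filterᵇ-filterᵇ p q xs
... | true with q x
...   | true = cong (x ∷_) (filterᵇ-filterᵇ p q xs)
...   | false = filterᵇ-filterᵇ p q xs

filterᵇ-cong : ∀ {A : Set} {p q : A → Bool} {xs} → All (λ x → p x ≡ q x) xs →
               filterᵇ p xs ≡ filterᵇ q xs
filterᵇ-cong [] = refl
filterᵇ-cong {q = q} {x ∷ _} (px≡qx ∷ eqs) rewrite px≡qx with q x
... | true = cong (x ∷_) (filterᵇ-cong eqs)
... | false = filterᵇ-cong eqs

filterᵇ-upTo-suc : ∀ (p : ℕ → Bool) n → ¬ T (p 0) →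
                   filterᵇ p (upTo (suc n)) ≡ filterᵇ p (map suc (upTo n))
filterᵇ-upTo-suc p n ¬p0 = trans (filter-reject (T? ∘ p) ¬p0) (cong (filterᵇ p) (sym (map-upTo suc n)))

sum-filterᵇ : ∀ (p : ℕ → Bool) xs → sum (filterᵇ p xs) ≡ sum (map (λ x → if p x then x else 0) xs)
sum-filterᵇ p [] = refl
sum-filterᵇ p (x ∷ xs) with p x
... | true = cong (x +_) (sum-filterᵇ p xs)
... | false = sum-filterᵇ p xs

sum-applyUpTo-suc : ∀ (g : ℕ → ℕ) n → sum (applyUpTo g (suc n)) ≡ sum (applyUpTo g n) + g n
sum-applyUpTo-suc g n = begin
  sum (applyUpTo g (suc n))       ≡⟨ cong sum (applyUpTo-∷ʳ g n) ⟨
  sum (applyUpTo g n ∷ʳ g n)      ≡⟨ sum-++ (applyUpTo g n) (g n ∷ []) ⟩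
  sum (applyUpTo g n) + (g n + 0) ≡⟨ cong (sum (applyUpTo g n) +_) (+-identityʳ (g n)) ⟩
  sum (applyUpTo g n) + g n       ∎
  where open ≡-Reasoning

∣-sum-applyUpTo-paired : ∀ d n (g : ℕ → ℕ) →
                         (∀ i j → i + j ≡ n → d ∣ g i + g j) → (∀ i → i + i ≡ n → d ∣ g i) →
                         d ∣ sum (applyUpTo g (suc n))
∣-sum-applyUpTo-paired d zero g pair mid = subst (d ∣_) (sym (+-identityʳ (g 0))) (mid 0 refl)
∣-sum-applyUpTo-paired d (suc zero) g pair mid =
  subst (d ∣_) (cong (g 0 +_) (sym (+-identityʳ (g 1)))) (pair 0 1 refl)
∣-sum-applyUpTo-paired d (suc (suc n)) g pair mid =
  subst (d ∣_) (sym outer≡) (∣m∣n⇒∣m+n (pair 0 (2 + n) refl) inner)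
  where
    inner : d ∣ sum (applyUpTo (g ∘ suc) (suc n))
    inner = ∣-sum-applyUpTo-paired d n (g ∘ suc)
      (λ i j i+j≡n → pair (suc i) (suc j) (cong suc (trans (+-suc i j) (cong suc i+j≡n))))
      (λ i i+i≡n → mid (suc i) (cong suc (trans (+-suc i i) (cong suc i+i≡n))))
    outer≡ : sum (applyUpTo g (3 + n)) ≡ g 0 + g (2 + n) + sum (applyUpTo (g ∘ suc) (suc n))
    outer≡ = trans (cong (g 0 +_) (sum-applyUpTo-suc (g ∘ suc) (suc n)))
                   (reorder (g 0) (sum (applyUpTo (g ∘ suc) (suc n))) (g (2 + n)))
      where
        reorder : ∀ a s b → a + (s + b) ≡ a + b + s
        reorder = solve-∀

∣-sum-filterᵇ-symmetric : ∀ n (p : ℕ → Bool) →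
                          (∀ i j → i + j ≡ n → p i ≡ p j) → (∀ i → i + i ≡ n → p i ≡ false) →
                          n ∣ sum (filterᵇ p (upTo (suc n)))
∣-sum-filterᵇ-symmetric n p p-sym p-mid =
  subst (n ∣_) (sym (trans (sum-filterᵇ p (upTo (suc n))) (cong sum (map-upTo g (suc n)))))
        (∣-sum-applyUpTo-paired n n g pair mid)
  where
    g : ℕ → ℕ
    g i = if p i then i else 0
    pair : ∀ i j → i + j ≡ n → n ∣ g i + g j
    pair i j i+j≡n rewrite p-sym i j i+j≡n with p j
    ... | true  = subst (n ∣_) (sym i+j≡n) ∣-refl
    ... | false = n ∣0
    mid : ∀ i → i + i ≡ n → n ∣ g i
    mid i i+i≡n rewrite p-mid i i+i≡n = n ∣0

gcd[i,i+j]≡gcd[i,j] : ∀ i j → gcd i (i + j) ≡ gcd i j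
gcd[i,i+j]≡gcd[i,j] i j = GCD.unique (gcd-GCD i (i + j)) (GCD.step (gcd-GCD i j))

gcd[i,i+i]≡i : ∀ i → gcd i (i + i) ≡ i
gcd[i,i+i]≡i i = GCD.unique (gcd-GCD i (i + i)) (GCD.step GCD.refl)

module Residues (m : ℕ) .{{_ : NonZero m}} where

  infix 4 _≋_
  _≋_ : ℕ → ℕ → Set
  x ≋ y = x % m ≡ y % m

  *-cong-≋ : ∀ {a b c d} → a ≋ b → c ≋ d → a * c ≋ b * d
  *-cong-≋ {a} {b} {c} {d} a≋b c≋d = begin
    a * c % m             ≡⟨ %-distribˡ-* a c m ⟩
    (a % m) * (c % m) % m ≡⟨ cong₂ (λ u v → u * v % m) a≋b c≋d ⟩
    (b % m) * (d % m) % m ≡⟨ %-distribˡ-* b d m ⟨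
    b * d % m             ∎
    where open ≡-Reasoning

  ^-cong-≋ : ∀ {a b} → a ≋ b → ∀ k → a ^ k ≋ b ^ k
  ^-cong-≋ a≋b zero    = refl
  ^-cong-≋ a≋b (suc k) = *-cong-≋ a≋b (^-cong-≋ a≋b k)

  ^-multiple-≋1 : ∀ {x δ} → x ^ δ ≋ 1 → ∀ q → x ^ (q * δ) ≋ 1
  ^-multiple-≋1 {x} {δ} xδ q = begin
    x ^ (q * δ) % m ≡⟨ cong (λ e → x ^ e % m) (*-comm q δ) ⟩
    x ^ (δ * q) % m ≡⟨ cong (_% m) (^-*-assoc x δ q) ⟨
    (x ^ δ) ^ q % m ≡⟨ ^-cong-≋ xδ q ⟩
    1 ^ q % m       ≡⟨ cong (_% m) (^-zeroˡ q) ⟩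
    1 % m           ∎
    where open ≡-Reasoning

  ^-cong-even : ∀ {x y e} → x ^ 2 ≋ y ^ 2 → 2 ∣ e → x ^ e ≋ y ^ e
  ^-cong-even {x} {y} sq (divides-refl t) = begin
    x ^ (t * 2) % m ≡⟨ cong (_% m) (even-power x) ⟩
    (x ^ 2) ^ t % m ≡⟨ ^-cong-≋ sq t ⟩
    (y ^ 2) ^ t % m ≡⟨ cong (_% m) (even-power y) ⟨
    y ^ (t * 2) % m ∎
    where
      open ≡-Reasoning
      even-power : ∀ z → z ^ (t * 2) ≡ (z ^ 2) ^ t
      even-power z = trans (cong (z ^_) (*-comm t 2)) (sym (^-*-assoc z 2 t))

  record HasOrder (x δ : ℕ) : Set where
    constructor hasOrder
    field
      pow-order≋1 : x ^ δ ≋ 1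
      minimal     : ∀ {k} → 0 < k → k < δ → ¬ x ^ k ≋ 1

  order-∣ : ∀ {x δ j} → .{{NonZero δ}} → HasOrder x δ → x ^ j ≋ 1 → δ ∣ j
  order-∣ {x} {δ} {j} (hasOrder xδ≋1 minimal) xʲ≋1 = m%n≡0⇒n∣m j δ j%δ≡0
    where
      x^[j%δ]≋1 : x ^ (j % δ) ≋ 1
      x^[j%δ]≋1 = begin
        x ^ (j % δ) % m                       ≡⟨ cong (_% m) (*-identityʳ _) ⟨
        x ^ (j % δ) * 1 % m                   ≡⟨ *-cong-≋ {x ^ (j % δ)} refl x^[j/δ*δ]≋1 ⟨
        x ^ (j % δ) * x ^ (j / δ * δ) % m     ≡⟨ cong (_% m) (^-distribˡ-+-* x (j % δ) (j / δ * δ)) ⟨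
        x ^ (j % δ + j / δ * δ) % m           ≡⟨ cong (λ e → x ^ e % m) (m≡m%n+[m/n]*n j δ) ⟨
        x ^ j % m                             ≡⟨ xʲ≋1 ⟩
        1 % m                                 ∎
        where
          open ≡-Reasoning
          x^[j/δ*δ]≋1 = ^-multiple-≋1 {x} xδ≋1 (j / δ)
      j%δ≡0 : j % δ ≡ 0
      j%δ≡0 with j % δ | m%n<n j δ | x^[j%δ]≋1
      ... | zero  | _   | _  = refl
      ... | suc r | r<δ | xr = contradiction xr (minimal z<s r<δ)

  HasOrder-cong-square : ∀ {x y δ} → x ^ 2 ≋ y ^ 2 → 4 ∣ δ → HasOrder x δ → HasOrder y δ
  HasOrder-cong-square {x} {y} {δ} sq 4∣δ x-order@(hasOrder xδ≋1 x-minimal) = hasOrder yδ≋1 y-minimal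
    where
      yδ≋1 : y ^ δ ≋ 1
      yδ≋1 = trans (sym (^-cong-even sq (∣-trans (divides 2 refl) 4∣δ))) xδ≋1
      y-minimal : ∀ {k} → 0 < k → k < δ → ¬ y ^ k ≋ 1
      y-minimal {k} 0<k k<δ yᵏ≋1 = x-minimal 0<k k<δ (trans (^-cong-even sq 2∣k) yᵏ≋1)
        where
          instance _ = >-nonZero (<-trans 0<k k<δ)
          y^[k*2]≋1 : y ^ (k * 2) ≋ 1
          y^[k*2]≋1 = trans (cong (_% m) (sym (^-*-assoc y k 2))) (^-cong-≋ yᵏ≋1 2)
          δ∣k*2 : δ ∣ k * 2
          δ∣k*2 = order-∣ x-order (trans (^-cong-even sq (n∣m*n k)) y^[k*2]≋1)
          2∣k : 2 ∣ k
          2∣k = *-cancelʳ-∣ 2 (∣-trans 4∣δ δ∣k*2)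

  T-powOneᵇ : ∀ a k → T (powOneᵇ m a k) ⇔ a ^ k ≋ 1
  T-powOneᵇ a k = mk⇔ (≡ᵇ⇒≡ _ _) (≡⇒≡ᵇ _ _)

  T-hasIndᵇ : ∀ a d → T (hasIndᵇ m a (suc d)) ⇔ HasOrder a (suc d)
  T-hasIndᵇ a d = mk⇔ to from
    where
      to : T (hasIndᵇ m a (suc d)) → HasOrder a (suc d)
      to t = hasOrder (Equivalence.to (T-powOneᵇ a (suc d)) (proj₁ (Equivalence.to T-∧ t))) minimal
        where
          minimal : ∀ {k} → 0 < k → k < suc d → ¬ a ^ k ≋ 1
          minimal {suc i} _ (s<s i<d) =
            Equivalence.to T-not (applyUpTo⁻ _ d (all⁺ _ _ (proj₂ (Equivalence.to T-∧ t))) i<d)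
            ∘ Equivalence.from (T-powOneᵇ a (suc i))
      from : HasOrder a (suc d) → T (hasIndᵇ m a (suc d))
      from (hasOrder aᵟ≋1 minimal) =
        Equivalence.from T-∧ (Equivalence.from (T-powOneᵇ a (suc d)) aᵟ≋1 , all⁻ _ below)
        where
          below = applyUpTo⁺₁ _ d λ {i} i<d →
            Equivalence.from T-not (minimal z<s (s<s i<d) ∘ Equivalence.to (T-powOneᵇ a (suc i)))

  hasIndᵇ-cong-square : ∀ {x y δ} → x ^ 2 ≋ y ^ 2 → 4 ∣ δ → hasIndᵇ m x δ ≡ hasIndᵇ m y δ
  hasIndᵇ-cong-square {δ = zero}  _  _   = refl
  hasIndᵇ-cong-square {x} {y} {suc d} sq 4∣δ =
    T-⇔⇒≡ (⇔.trans (T-hasIndᵇ x d) (⇔.trans order⇔ (⇔.sym (T-hasIndᵇ y d))))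
    where order⇔ = mk⇔ (HasOrder-cong-square sq 4∣δ) (HasOrder-cong-square (sym sq) 4∣δ)

  square-complement : ∀ i j → i + j ≡ m → i ^ 2 ≋ j ^ 2
  square-complement i j i+j≡m = begin
    i ^ 2 % m           ≡⟨ [m+kn]%n≡m%n (i ^ 2) j m ⟨
    (i ^ 2 + j * m) % m ≡⟨ cong (_% m) (expand i+j≡m) ⟩
    (j ^ 2 + i * m) % m ≡⟨ [m+kn]%n≡m%n (j ^ 2) i m ⟩
    j ^ 2 % m           ∎
    where
      open ≡-Reasoning
      expand : ∀ {n} → i + j ≡ n → i ^ 2 + j * n ≡ j ^ 2 + i * n
      expand refl = identity i j
        where
          identity : ∀ a b → a * (a * 1) + b * (a + b) ≡ b * (b * 1) + a * (a + b)
          identity = solve-∀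

  unitᵇ : ℕ → Bool
  unitᵇ a = gcd a m ≡ᵇ 1

  gcd-complement : ∀ i j → i + j ≡ m → gcd i m ≡ gcd j m
  gcd-complement i j i+j≡m = begin
    gcd i m       ≡⟨ cong (gcd i) i+j≡m ⟨
    gcd i (i + j) ≡⟨ gcd[i,i+j]≡gcd[i,j] i j ⟩
    gcd i j       ≡⟨ gcd-comm i j ⟩
    gcd j i       ≡⟨ gcd[i,i+j]≡gcd[i,j] j i ⟨
    gcd j (j + i) ≡⟨ cong (gcd j) (trans (+-comm j i) i+j≡m) ⟩
    gcd j m       ∎
    where open ≡-Reasoning

  unitᵇ-complement : ∀ i j → i + j ≡ m → unitᵇ i ≡ unitᵇ j
  unitᵇ-complement i j i+j≡m = cong (_≡ᵇ 1) (gcd-complement i j i+j≡m)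

  unitᵇ-half : ∀ {i} → 2 < m → i + i ≡ m → unitᵇ i ≡ false
  unitᵇ-half {i} 2<m i+i≡m rewrite sym i+i≡m | gcd[i,i+i]≡i i = ≢1 i 2<m
    where
      ≢1 : ∀ i → 2 < i + i → (i ≡ᵇ 1) ≡ false
      ≢1 (suc (suc _)) _ = refl
      ≢1 (suc zero) (s<s (s<s ()))

  unitᵇ-zero : 1 < m → ∀ b → ¬ T (unitᵇ 0 ∧ b)
  unitᵇ-zero 1<m b t = <⇒≢ 1<m (sym (trans (sym (gcd-identityˡ m)) (≡ᵇ⇒≡ _ 1 unit0)))
    where unit0 = proj₁ (Equivalence.to (T-∧ {unitᵇ 0} {b}) t)

  unitᵇ-one : T (unitᵇ 1)
  unitᵇ-one = subst (λ g → T (g ≡ᵇ 1)) (sym (gcd-zeroˡ m)) _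

  1<a≤m⇒¬a≋1 : ∀ {a} → 1 < a → a ≤ m → ¬ a ≋ 1
  1<a≤m⇒¬a≋1 {a} 1<a a≤m a≋1 with m≤n⇒m<n∨m≡n a≤m
  ... | inj₁ a<m = <⇒≢ 1<a (sym (trans (sym (m<n⇒m%n≡m a<m)) (trans a≋1 (m<n⇒m%n≡m (<-trans 1<a a<m)))))
  ... | inj₂ a≡m = 0≢1+n (trans (sym (n%n≡0 m)) (trans (cong (_% m) (sym a≡m)) (trans a≋1 1%m≡1)))
    where 1%m≡1 = m<n⇒m%n≡m (subst (1 <_) a≡m 1<a)

  powOneᵇ-one : ∀ k → T (powOneᵇ m 1 k)
  powOneᵇ-one k = Equivalence.from (T-powOneᵇ 1 k) (cong (_% m) (^-zeroˡ k))

  ∣-sum-units-symmetric : 2 < m → (Q : ℕ → Bool) → (∀ i j → i + j ≡ m → Q i ≡ Q j) →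
                          m ∣ sum (filterᵇ (λ a → unitᵇ a ∧ Q a) (upTo (suc m)))
  ∣-sum-units-symmetric 2<m Q Q-complement = ∣-sum-filterᵇ-symmetric m (λ a → unitᵇ a ∧ Q a)
    (λ i j i+j≡m → cong₂ _∧_ (unitᵇ-complement i j i+j≡m) (Q-complement i j i+j≡m))
    (λ i i+i≡m → cong (_∧ Q i) (unitᵇ-half {i} 2<m i+i≡m))

  sumInd≡sum-upTo : 1 < m → ∀ δ →
                    sumInd m δ ≡ sum (filterᵇ (λ a → unitᵇ a ∧ hasIndᵇ m a δ) (upTo (suc m)))
  sumInd≡sum-upTo 1<m δ = cong sum (trans (filterᵇ-filterᵇ unitᵇ Ind (map suc (upTo m)))
                                          (sym (filterᵇ-upTo-suc _ m (unitᵇ-zero 1<m (Ind 0)))))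
    where
      Ind : ℕ → Bool
      Ind a = hasIndᵇ m a δ

  ∣-sumInd : 2 < m → ∀ {δ} → 4 ∣ δ → m ∣ sumInd m δ
  ∣-sumInd 2<m {δ} 4∣δ = subst (m ∣_) (sym (sumInd≡sum-upTo (<-trans (s<s z<s) 2<m) δ))
    (∣-sum-units-symmetric 2<m (λ a → hasIndᵇ m a δ)
      λ i j i+j≡m → hasIndᵇ-cong-square (square-complement i j i+j≡m) 4∣δ)

module _ (n : ℕ) where
  open Residues (2 + n)

  -- units (2 + n) unfolds definitionally to a filter of 1 ∷ [2,2+n].
  [2,2+n] : List ℕ
  [2,2+n] = map suc (applyUpTo suc (suc n))

  [2,2+n]-≢1 : All (λ a → ¬ T (powOneᵇ (2 + n) a 1)) [2,2+n]
  [2,2+n]-≢1 = map⁺ (applyUpTo⁺₁ suc (suc n) λ { {i} (s≤s i≤n) →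
    1<a≤m⇒¬a≋1 (s<s (s<s z≤n)) (s≤s (s≤s i≤n))
    ∘ subst (_≋ 1) (^-identityʳ (2 + i)) ∘ Equivalence.to (T-powOneᵇ (2 + i) 1) })

  hasIndᵇ2≡powOneᵇ2 : ∀ a → ¬ T (powOneᵇ (2 + n) a 1) → hasIndᵇ (2 + n) a 2 ≡ powOneᵇ (2 + n) a 2
  hasIndᵇ2≡powOneᵇ2 a a≢1 with powOneᵇ (2 + n) a 1
  ... | false = ∧-identityʳ _
  ... | true  = contradiction _ a≢1

  sumInd[1] : sumInd (2 + n) 1 ≡ 1
  sumInd[1] = begin
    sumInd (2 + n) 1               ≡⟨ cong sum (filterᵇ-filterᵇ unitᵇ Ind1 (1 ∷ [2,2+n])) ⟩
    sum (filterᵇ P (1 ∷ [2,2+n]))  ≡⟨ cong sum (filter-accept (T? ∘ P) {1} {[2,2+n]} P1) ⟩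
    1 + sum (filterᵇ P [2,2+n])    ≡⟨ cong ((1 +_) ∘ sum) (filter-none (T? ∘ P) {[2,2+n]} ¬P[2,2+n]) ⟩
    1                              ∎
    where
      open ≡-Reasoning
      Ind1 P : ℕ → Bool
      Ind1 a = hasIndᵇ (2 + n) a 1
      P a = unitᵇ a ∧ Ind1 a
      P1 : T (P 1)
      P1 = Equivalence.from T-∧ (unitᵇ-one , Equivalence.from T-∧ (powOneᵇ-one 1 , _))
      ¬P[2,2+n] : All (¬_ ∘ T ∘ P) [2,2+n]
      ¬P[2,2+n] = All.map (λ {a} a≢1 → a≢1 ∘ proj₁ ∘ Equivalence.to T-∧ ∘ proj₂
                                          ∘ Equivalence.to (T-∧ {unitᵇ a}))
                          [2,2+n]-≢1

  sum-square-roots : sum (filterᵇ (λ a → unitᵇ a ∧ powOneᵇ (2 + n) a 2) (upTo (3 + n)))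
                     ≡ sumInd (2 + n) 2 + 1
  sum-square-roots = begin
    sum (filterᵇ S (upTo (3 + n)))      ≡⟨ cong sum (filterᵇ-upTo-suc S (2 + n) ¬S0) ⟩
    sum (filterᵇ S (1 ∷ [2,2+n]))       ≡⟨ cong sum (filter-accept (T? ∘ S) {1} {[2,2+n]} S1) ⟩
    1 + sum (filterᵇ S [2,2+n])         ≡⟨ cong ((1 +_) ∘ sum) (filterᵇ-cong S≡P-on-[2,2+n]) ⟩
    1 + sum (filterᵇ P [2,2+n])         ≡⟨ cong ((1 +_) ∘ sum) (filter-reject (T? ∘ P) {1} {[2,2+n]} ¬P1) ⟨
    1 + sum (filterᵇ P (1 ∷ [2,2+n]))   ≡⟨ cong ((1 +_) ∘ sum) (filterᵇ-filterᵇ unitᵇ Ind2 (1 ∷ [2,2+n])) ⟨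
    1 + sumInd (2 + n) 2                ≡⟨ +-comm 1 (sumInd (2 + n) 2) ⟩
    sumInd (2 + n) 2 + 1                ∎
    where
      open ≡-Reasoning
      Ind2 S P : ℕ → Bool
      Ind2 a = hasIndᵇ (2 + n) a 2
      S a = unitᵇ a ∧ powOneᵇ (2 + n) a 2
      P a = unitᵇ a ∧ Ind2 a
      ¬S0 : ¬ T (S 0)
      ¬S0 = unitᵇ-zero (s<s z<s) (powOneᵇ (2 + n) 0 2)
      S1 : T (S 1)
      S1 = Equivalence.from T-∧ (unitᵇ-one , powOneᵇ-one 2)
      -- hasIndᵇ (2 + n) 1 2 computes to false.
      ¬P1 : ¬ T (P 1)
      ¬P1 = proj₂ ∘ Equivalence.to (T-∧ {unitᵇ 1})
      S≡P : ∀ {a} → ¬ T (powOneᵇ (2 + n) a 1) → S a ≡ P a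
      S≡P {a} a≢1 = cong (unitᵇ a ∧_) (sym (hasIndᵇ2≡powOneᵇ2 a a≢1))
      S≡P-on-[2,2+n] : All (λ a → S a ≡ P a) [2,2+n]
      S≡P-on-[2,2+n] = All.map (λ {a} → S≡P {a}) [2,2+n]-≢1

sumInd[1]≡1 : ∀ m .{{_ : NonZero m}} → sumInd m 1 % m ≡ 1 % m
sumInd[1]≡1 1             = trans (n%1≡0 (sumInd 1 1)) (sym (n%1≡0 1))
sumInd[1]≡1 (suc (suc n)) = cong (_% (2 + n)) (sumInd[1] n)

∣-sumInd[2]+1 : ∀ m .{{_ : NonZero m}} → 2 < m → m ∣ sumInd m 2 + 1
∣-sumInd[2]+1 (suc (suc n)) 2<m = subst (2 + n ∣_) (sum-square-roots n)
  (∣-sum-units-symmetric 2<m (λ a → powOneᵇ (2 + n) a 2)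
    λ i j i+j≡m → cong (_≡ᵇ 1 % (2 + n)) (square-complement i j i+j≡m))
  where open Residues (2 + n)
∣-sumInd[2]+1 1 (s<s ())

units-≤2-trivial : ∀ m .{{_ : NonZero m}} → m ≤ 2 → ∀ a → Coprime a m → a ^ 1 % m ≡ 1 % m
units-≤2-trivial 1 _ a _ = trans (n%1≡0 (a ^ 1)) (sym (n%1≡0 1))
units-≤2-trivial 2 _ a coprime = trans (cong (_% 2) (^-identityʳ a)) odd
  where
    odd : a % 2 ≡ 1
    odd with a % 2 in a%2≡r | m%n<n a 2
    ... | 0 | _ = contradiction (coprime (m%n≡0⇒n∣m a 2 a%2≡r , ∣-refl)) λ ()
    ... | 1 | _ = refl
    ... | suc (suc _) | s<s (s<s ())
units-≤2-trivial (suc (suc (suc _))) (s≤s (s≤s ()))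

carmichael-≤2 : ∀ {m L} .{{_ : NonZero m}} → IsCarmichael m L → m ≤ 2 → L ≡ 1
carmichael-≤2 {m} (0<L , _ , minimal) m≤2 =
  ≤-antisym (≮⇒≥ λ 1<L → minimal 1 z<s 1<L (units-≤2-trivial m m≤2)) 0<L

carmichael-2≤∣⇒2<m : ∀ {m L δ} .{{_ : NonZero m}} → IsCarmichael m L → δ ∣ L → 2 ≤ δ → 2 < m
carmichael-2≤∣⇒2<m carmichael δ∣L 2≤δ = ≰⇒> λ m≤2 →
  <⇒≢ 2≤δ (sym (∣1⇒≡1 (subst (_ ∣_) (carmichael-≤2 carmichael m≤2) δ∣L)))

theorem1p6 : (m : ℕ) → .{{_ : NonZero m}} → (L δ : ℕ) → IsCarmichael m L → 0 < δ → δ ∣ L →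
    (δ ≡ 1 → sumInd m δ % m ≡ 1 % m)
  × (δ ≡ 2 → (sumInd m δ + 1) % m ≡ 0)
  × (4 ∣ δ → sumInd m δ % m ≡ 0)
theorem1p6 m L δ carmichael 0<δ δ∣L = part1 , part2 , part3
  where
    open Residues m using (∣-sumInd)
    2<m : 2 ≤ δ → 2 < m
    2<m = carmichael-2≤∣⇒2<m carmichael δ∣L
    part1 : δ ≡ 1 → sumInd m δ % m ≡ 1 % m
    part1 δ≡1 = subst (λ d → sumInd m d % m ≡ 1 % m) (sym δ≡1) (sumInd[1]≡1 m)
    part2 : δ ≡ 2 → (sumInd m δ + 1) % m ≡ 0
    part2 δ≡2 = subst (λ d → (sumInd m d + 1) % m ≡ 0) (sym δ≡2)
                      (n∣m⇒m%n≡0 _ m (∣-sumInd[2]+1 m (2<m (≤-reflexive (sym δ≡2)))))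
    part3 : 4 ∣ δ → sumInd m δ % m ≡ 0
    part3 4∣δ = n∣m⇒m%n≡0 _ m (∣-sumInd (2<m 2≤δ) 4∣δ)
      where 2≤δ = ≤-trans (s≤s (s≤s z≤n)) (∣⇒≤ {{>-nonZero 0<δ}} 4∣δ)
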